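{- For every graph $\Gamma$ and every integer $n\ge 2$, the iterated direct product $\times_{i=1}^{n}\Gamma$ of $n$ copies of $\Gamma$ contains an induced subgraph isomorphic to $\Gamma\times\Gamma$.
   Context: All graphs are finite, simple and undirected. The direct product $G\times H$ has vertex set $V(G)\times V(H)$, with $\{(u,v),(u',v')\}$ an edge iff $\{u,u'\}\in E(G)$ and $\{v,v'\}\in E(H)$; it is iterated as $\times_{i=1}^{n}\Gamma_i=(\times_{i=1}^{n-1}\Gamma_i)\times\Gamma_n$. -}

module Defs where

open import Level using (0ℓ)
open import Data.Nat using (ℕ; zero; suc; _≥_)
open import Data.Fin using (Fin)
open import Data.Product using (_×_; _,_; Σ)
open import Data.Empty using (⊥)
open import Relation.Nullary using (¬_)
open import Relation.Binary.PropositionalEquality using (_≡_)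
open import Function.Bundles using (_↔_; _⇔_)
open import Function.Definitions using (Injective)

record Graph : Set₁ where
  field
    V       : Set
    size    : ℕ
    finite  : V ↔ Fin size
    Adj     : V → V → Set
    sym     : ∀ {u v} → Adj u v → Adj v u
    irrefl  : ∀ {u} → ¬ Adj u u
open Graph public

_⊗_ : Graph → Graph → Graph
G ⊗ H = record
  { V      = V G × V H
  ; size   = size G Data.Nat.* size H
  ; finite = finProd
  ; Adj    = λ { (u , v) (u' , v') → Adj G u u' × Adj H v v' }
  ; sym    = λ { (a , b) → sym G a , sym H b }
  ; irrefl = λ { (a , _) → irrefl G a }
  }
  where
  open import Function.Properties.Inverse using (↔-trans)
  open import Data.Product.Function.NonDependent.Propositional using (_×-↔_)
  open import Data.Fin.Properties using (*↔×)
  open import Function.Properties.Inverse using (↔-sym)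
  finProd : (V G × V H) ↔ Fin (size G Data.Nat.* size H)
  finProd = ↔-trans (finite G ×-↔ finite H) (↔-sym *↔×)

-- Iterated direct product of n ≥ 1 copies: power Γ 1 = Γ,
-- power Γ (n+1) = power Γ n × Γ.  (For n = 0 we set it to Γ as a junk value;
-- the theorem only uses n ≥ 2.)
power : Graph → ℕ → Graph
power Γ zero          = Γ
power Γ (suc zero)    = Γ
power Γ (suc (suc n)) = power Γ (suc n) ⊗ Γ

record InducedEmbedding (G H : Graph) : Set where
  field
    map       : V G → V H
    injective : ∀ {x y} → map x ≡ map y → x ≡ y
    adj-iff   : ∀ x y → Adj G x y ⇔ Adj H (map x) (map y)

_↪ᵢ_ : Graph → Graph → Set
G ↪ᵢ H = InducedEmbedding G H

{-# OPTIONS --safe #-}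
-- Iterating the diagonal u ↦ (u , u) embeds Γ induced into Γⁿ⁻¹, and then
-- (u , v) ↦ (diag u , v) embeds Γ ⊗ Γ into Γⁿ⁻¹ ⊗ Γ = Γⁿ.
module Submission where

open import Defs
open import Data.Nat using (ℕ; zero; suc; _≥_; s≤s; z≤n)
open import Data.Product using (_,_; proj₁)
open import Data.Product.Properties using (×-≡,≡→≡; ×-≡,≡←≡)
open import Data.Product.Function.NonDependent.Propositional using (_×-⇔_)
open import Function using (_∘_; id)
open import Function.Bundles using (mk⇔)
open import Function.Construct.Identity using (⇔-id)
open import Function.Construct.Composition using (_⇔-∘_)

open InducedEmbedding

↪ᵢ-refl : (G : Graph) → G ↪ᵢ G
↪ᵢ-refl G = record
  { map       = id
  ; injective = id
  ; adj-iff   = λ x y → ⇔-id (Adj G x y)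
  }

↪ᵢ-trans : {G H K : Graph} → G ↪ᵢ H → H ↪ᵢ K → G ↪ᵢ K
↪ᵢ-trans e f = record
  { map       = map f ∘ map e
  ; injective = injective e ∘ injective f
  ; adj-iff   = λ x y → adj-iff f (map e x) (map e y) ⇔-∘ adj-iff e x y
  }

⊗-↪ᵢ : {G H G′ H′ : Graph} → G ↪ᵢ H → G′ ↪ᵢ H′ → (G ⊗ G′) ↪ᵢ (H ⊗ H′)
⊗-↪ᵢ e f = record
  { map       = λ { (x , y) → map e x , map f y }
  ; injective = λ eq → let (p , q) = ×-≡,≡←≡ eq
                       in ×-≡,≡→≡ (injective e p , injective f q)
  ; adj-iff   = λ { (x , y) (x′ , y′) → adj-iff e x x′ ×-⇔ adj-iff f y y′ }
  }

↪ᵢ-⊗-self : (Γ : Graph) → Γ ↪ᵢ (Γ ⊗ Γ)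
↪ᵢ-⊗-self Γ = record
  { map       = λ u → u , u
  ; injective = proj₁ ∘ ×-≡,≡←≡
  ; adj-iff   = λ _ _ → mk⇔ (λ a → a , a) proj₁
  }

↪ᵢ-power-diagonal : (Γ : Graph) (k : ℕ) → Γ ↪ᵢ power Γ (suc k)
↪ᵢ-power-diagonal Γ zero    = ↪ᵢ-refl Γ
↪ᵢ-power-diagonal Γ (suc k) =
  ↪ᵢ-trans (↪ᵢ-⊗-self Γ) (⊗-↪ᵢ (↪ᵢ-power-diagonal Γ k) (↪ᵢ-refl Γ))

mainTheorem12 : (Γ : Graph) (n : ℕ) → n ≥ 2 → (Γ ⊗ Γ) ↪ᵢ power Γ n
mainTheorem12 Γ (suc (suc k)) (s≤s (s≤s z≤n)) =
  ⊗-↪ᵢ (↪ᵢ-power-diagonal Γ k) (↪ᵢ-refl Γ)
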